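{- Let $H$ be a hypergraph, and let $\mathcal{E}(H)$ denote the number of edges of $H$ that are not singleton, empty, or duplicate edges. Then $|V(H)|-\mathcal{E}(H)\leq b(H)$.
   Context: A hypergraph $H$ consists of a nonempty finite vertex set $V(H)$ and a finite family $E(H)$ of edges, each a subset of $V(H)$; distinct edges with the same vertex set (parallel edges) are permitted. For the count $\mathcal{E}(H)$, among each class of parallel edges one is regarded as the original and the others as duplicates, so each class of parallel edges of size at least two contributes exactly $1$. Round-based burning: let $F_0=\emptyset$. In each round $r=1,2,\ldots$ simultaneously: every vertex $v\notin F_{r-1}$ for which there is an edge $e$ with $|e|\geq 2$, $v\in e$ and $e\setminus\{v\}\subseteq F_{r-1}$ catches fire; and a chosen vertex $u_r\notin F_{r-1}$ (a source) is set on fire. $F_r$ is $F_{r-1}$ together with all vertices set on fire in round $r$. A sequence $(u_1,\ldots,u_k)$ with $u_r\notin F_{r-1}$ for all $r$ and $F_k=V(H)$ is a burning sequence; $b(H)$ is the minimum length of a burning sequence. -}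

module Defs where

open import Data.Nat using (ℕ; suc; _≤_; _≤?_; _+_)
open import Data.Fin using (Fin)
open import Data.Fin.Subset using (Subset; _∈_; _∉_; ∣_∣; ⊥)
open import Data.Vec.Properties using (≡-dec)
open import Data.Bool.Properties using () renaming (_≟_ to _≟𝔹_)
open import Data.List using (List; []; _∷_; length; filter; deduplicate)
open import Data.List.Membership.Propositional using () renaming (_∈_ to _∈ₗ_)
open import Data.Product using (Σ; ∃; _×_)
open import Data.Sum using (_⊎_)
open import Relation.Binary.PropositionalEquality using (_≡_; _≢_)
open import Relation.Nullary using (¬_)
open import Relation.Unary using () renaming (Decidable to DecidableU)

-- A hypergraph with nonempty vertex set Fin (suc m) and a finite family
-- (list, so parallel edges allowed) of edges, each a subset of the vertices.
record Hypergraph : Set where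
  field
    m     : ℕ
    edges : List (Subset (suc m))

open Hypergraph public

nV : Hypergraph → ℕ
nV H = suc (m H)

Vertex : Hypergraph → Set
Vertex H = Fin (suc (m H))

calE : Hypergraph → ℕ
calE H = length (filter (λ e → 2 ≤? ∣ e ∣) (deduplicate (≡-dec _≟𝔹_) (edges H)))

Ignites : (H : Hypergraph) → Subset (nV H) → Vertex H → Set
Ignites H F v = v ∉ F × ∃ λ e → e ∈ₗ edges H × 2 ≤ ∣ e ∣ × v ∈ e
                × (∀ w → w ∈ e → w ≢ v → w ∈ F)

Step : (H : Hypergraph) → Subset (nV H) → Vertex H → Subset (nV H) → Set
Step H F u F' = u ∉ F × (∀ v → (v ∈ F' → (v ∈ F ⊎ v ≡ u ⊎ Ignites H F v))
                              × ((v ∈ F ⊎ v ≡ u ⊎ Ignites H F v) → v ∈ F'))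

data BurnsFrom (H : Hypergraph) : Subset (nV H) → List (Vertex H) → Set where
  done : ∀ {F} → (∀ v → v ∈ F) → BurnsFrom H F []
  step : ∀ {F F' u us} → Step H F u F' → BurnsFrom H F' us → BurnsFrom H F (u ∷ us)

IsBurningSequence : (H : Hypergraph) → List (Vertex H) → Set
IsBurningSequence H us = BurnsFrom H ⊥ us

-- Track the potential  Φ(G) = |G| + (number of proper edges not contained in G),
-- where the proper edges are the distinct edges with at least two vertices, so
-- Φ(∅) = 𝓔(H) and Φ(F) ≥ |V(H)| once everything burns. A round raises Φ by at
-- most one: setting the source on fire costs one, while a vertex v catching fire
-- through an edge e is paid for by e, which stops being uncovered exactly when v
-- is added. Building the new fire set one vertex at a time makes this accounting
-- precise, since distinct vertices catching fire in the same round use distinct edges.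
module Submission where

open import Defs
open import Data.Nat using (_≤_; _+_)
open import Data.List using (List; length)

open import Data.Nat using (ℕ; suc; _≤?_; z≤n; s≤s)
open import Data.Nat.Properties
  using (≤-refl; ≤-trans; ≤-reflexive; n≤1+n; m≤m+n; +-suc; +-mono-≤; +-monoˡ-≤; +-monoʳ-≤; +-identityʳ; module ≤-Reasoning)
open import Data.Fin using (Fin; zero; suc)
open import Data.Fin.Properties using () renaming (_≟_ to _≟ᶠ_)
open import Data.Fin.Subset using (Subset; _∈_; _∉_; _⊆_; _⊈_; ∣_∣; ⊥; ⊤; inside; outside)
open import Data.Fin.Subset.Properties using (_∈?_; _⊆?_; drop-∷-⊆; ⊆-refl; ⊆-trans; ⊆-antisym; p⊆q⇒∣p∣≤∣q∣; ∣⊤∣≡n; ∣⊥∣≡0)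
open import Data.Vec using (_∷_; here; there)
open import Data.Vec.Properties using (≡-dec)
open import Data.Bool.Properties using () renaming (_≟_ to _≟𝔹_)
open import Data.List using ([]; _∷_; foldl; filter; deduplicate; allFin)
open import Data.List.Membership.Propositional using () renaming (_∈_ to _∈ₗ_)
open import Data.List.Membership.Propositional.Properties using (∈-filter⁺; ∈-deduplicate⁺; ∈-allFin)
open import Data.List.Relation.Unary.Any using () renaming (here to hereₗ; there to thereₗ)
open import Data.Product using (_,_; proj₁; proj₂)
open import Data.Sum using (inj₁; inj₂)
open import Data.Empty using (⊥-elim)
open import Relation.Nullary using (yes; no; contradiction)
open import Relation.Binary.PropositionalEquality using (_≡_; refl; sym; cong)

private
  variable
    n : ℕ

insert : Fin n → Subset n → Subset n
insert zero    (_ ∷ p) = inside ∷ p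
insert (suc x) (b ∷ p) = b ∷ insert x p

x∈insert[x,p] : (x : Fin n) (p : Subset n) → x ∈ insert x p
x∈insert[x,p] zero    (_ ∷ p) = here
x∈insert[x,p] (suc x) (_ ∷ p) = there (x∈insert[x,p] x p)

p⊆insert[x,p] : (x : Fin n) {p : Subset n} → p ⊆ insert x p
p⊆insert[x,p] zero    here      = here
p⊆insert[x,p] zero    (there y) = there y
p⊆insert[x,p] (suc x) here      = here
p⊆insert[x,p] (suc x) (there y) = there (p⊆insert[x,p] x y)

x∈p⇒insert[x,p]≡p : (x : Fin n) {p : Subset n} → x ∈ p → insert x p ≡ p
x∈p⇒insert[x,p]≡p zero    here      = refl
x∈p⇒insert[x,p]≡p (suc x) (there y) = cong (_ ∷_) (x∈p⇒insert[x,p]≡p x y)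

insert-⊆ : {x : Fin n} {p q : Subset n} → x ∈ q → p ⊆ q → insert x p ⊆ q
insert-⊆ {x = zero}  {_ ∷ p}         x∈q         p⊆q here      = x∈q
insert-⊆ {x = zero}  {_ ∷ p}         x∈q         p⊆q (there y) = p⊆q (there y)
insert-⊆ {x = suc x} {_ ∷ p}         x∈q         p⊆q here      = p⊆q here
insert-⊆ {x = suc x} {_ ∷ p} {_ ∷ q} (there x∈q) p⊆q (there y) =
  there (insert-⊆ x∈q (drop-∷-⊆ p⊆q) y)

∣insert[x,p]∣≤1+∣p∣ : (x : Fin n) (p : Subset n) → ∣ insert x p ∣ ≤ suc ∣ p ∣
∣insert[x,p]∣≤1+∣p∣ zero    (inside  ∷ p) = n≤1+n _
∣insert[x,p]∣≤1+∣p∣ zero    (outside ∷ p) = ≤-refl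
∣insert[x,p]∣≤1+∣p∣ (suc x) (inside  ∷ p) = s≤s (∣insert[x,p]∣≤1+∣p∣ x p)
∣insert[x,p]∣≤1+∣p∣ (suc x) (outside ∷ p) = ∣insert[x,p]∣≤1+∣p∣ x p

module _ (T : Subset n) where

  insertIfIn : Subset n → Fin n → Subset n
  insertIfIn G x with x ∈? T
  ... | yes _ = insert x G
  ... | no  _ = G

  ⊆-insertIfIn : ∀ G x → G ⊆ insertIfIn G x
  ⊆-insertIfIn G x with x ∈? T
  ... | yes _ = p⊆insert[x,p] x
  ... | no  _ = ⊆-refl

  saturate : Subset n → List (Fin n) → Subset n
  saturate = foldl insertIfIn

  ⊆-saturate : ∀ {G} xs → G ⊆ saturate G xs
  ⊆-saturate []           = ⊆-refl
  ⊆-saturate {G} (x ∷ xs) = ⊆-trans (⊆-insertIfIn G x) (⊆-saturate xs)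

  saturate-⊆ : ∀ {G} xs → G ⊆ T → saturate G xs ⊆ T
  saturate-⊆ []       G⊆T = G⊆T
  saturate-⊆ {G} (x ∷ xs) G⊆T = saturate-⊆ xs insertIfIn-⊆
    where
    insertIfIn-⊆ : insertIfIn G x ⊆ T
    insertIfIn-⊆ with x ∈? T
    ... | yes x∈T = insert-⊆ x∈T G⊆T
    ... | no  _   = G⊆T

  ∈T∩xs⇒∈saturate : ∀ G {y} xs → y ∈ₗ xs → y ∈ T → y ∈ saturate G xs
  ∈T∩xs⇒∈saturate G (x ∷ xs) (hereₗ refl) x∈T = ⊆-saturate xs x∈insertIfIn
    where
    x∈insertIfIn : x ∈ insertIfIn G x
    x∈insertIfIn with x ∈? T
    ... | yes _   = x∈insert[x,p] x G
    ... | no  x∉T = contradiction x∈T x∉T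
  ∈T∩xs⇒∈saturate G (x ∷ xs) (thereₗ y∈xs) y∈T = ∈T∩xs⇒∈saturate (insertIfIn G x) xs y∈xs y∈T

  saturate-allFin : ∀ {G} → G ⊆ T → saturate G (allFin n) ≡ T
  saturate-allFin G⊆T =
    ⊆-antisym (saturate-⊆ (allFin n) G⊆T) (λ {y} → ∈T∩xs⇒∈saturate _ (allFin n) (∈-allFin y))

  module _ (Φ : Subset n → ℕ) {B : Subset n}
           (insertion-nonincreasing : ∀ {G} x → B ⊆ G → x ∈ T → Φ (insert x G) ≤ Φ G) where

    Φ-saturate≤ : ∀ {G} xs → B ⊆ G → Φ (saturate G xs) ≤ Φ G
    Φ-saturate≤ []       B⊆G = ≤-refl
    Φ-saturate≤ {G} (x ∷ xs) B⊆G =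
      ≤-trans (Φ-saturate≤ xs (⊆-trans B⊆G (⊆-insertIfIn G x))) Φ-insertIfIn≤
      where
      Φ-insertIfIn≤ : Φ (insertIfIn G x) ≤ Φ G
      Φ-insertIfIn≤ with x ∈? T
      ... | yes x∈T = insertion-nonincreasing x B⊆G x∈T
      ... | no  _   = ≤-refl

    Φ[T]≤Φ[B] : B ⊆ T → Φ T ≤ Φ B
    Φ[T]≤Φ[B] B⊆T = ≤-trans (≤-reflexive (cong Φ (sym (saturate-allFin B⊆T))))
                             (Φ-saturate≤ (allFin n) ⊆-refl)

uncovered : Subset n → List (Subset n) → ℕ
uncovered X []       = 0
uncovered X (e ∷ es) with e ⊆? X
... | yes _ = uncovered X es
... | no  _ = suc (uncovered X es)

uncovered≤length : (X : Subset n) (es : List (Subset n)) → uncovered X es ≤ length es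
uncovered≤length X []       = z≤n
uncovered≤length X (e ∷ es) with e ⊆? X
... | yes _ = ≤-trans (uncovered≤length X es) (n≤1+n _)
... | no  _ = s≤s (uncovered≤length X es)

uncovered-antitone : {X Y : Subset n} → X ⊆ Y → (es : List (Subset n)) → uncovered Y es ≤ uncovered X es
uncovered-antitone X⊆Y [] = z≤n
uncovered-antitone {X = X} {Y} X⊆Y (e ∷ es) with e ⊆? X | e ⊆? Y
... | yes _   | yes _   = uncovered-antitone X⊆Y es
... | yes e⊆X | no  e⊈Y = ⊥-elim (e⊈Y (⊆-trans e⊆X X⊆Y))
... | no  _   | yes _   = ≤-trans (uncovered-antitone X⊆Y es) (n≤1+n _)
... | no  _   | no  _   = s≤s (uncovered-antitone X⊆Y es)

uncovered-antitone-strict : {X Y e : Subset n} → X ⊆ Y → (es : List (Subset n)) →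
                            e ∈ₗ es → e ⊈ X → e ⊆ Y → suc (uncovered Y es) ≤ uncovered X es
uncovered-antitone-strict {X = X} {Y} X⊆Y (e ∷ es) (hereₗ refl) e⊈X e⊆Y with e ⊆? X | e ⊆? Y
... | yes e⊆X | _       = ⊥-elim (e⊈X e⊆X)
... | no  _   | yes _   = s≤s (uncovered-antitone X⊆Y es)
... | no  _   | no  e⊈Y = ⊥-elim (e⊈Y e⊆Y)
uncovered-antitone-strict {X = X} {Y} X⊆Y (f ∷ es) (thereₗ e∈es) e⊈X e⊆Y with f ⊆? X | f ⊆? Y
... | yes _   | yes _   = uncovered-antitone-strict X⊆Y es e∈es e⊈X e⊆Y
... | yes f⊆X | no  f⊈Y = ⊥-elim (f⊈Y (⊆-trans f⊆X X⊆Y))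
... | no  _   | yes _   = ≤-trans (uncovered-antitone-strict X⊆Y es e∈es e⊈X e⊆Y) (n≤1+n _)
... | no  _   | no  _   = s≤s (uncovered-antitone-strict X⊆Y es e∈es e⊈X e⊆Y)

module _ (H : Hypergraph) where

  properEdges : List (Subset (nV H))
  properEdges = filter (λ e → 2 ≤? ∣ e ∣) (deduplicate (≡-dec _≟𝔹_) (edges H))

  ∈-properEdges : ∀ {e} → e ∈ₗ edges H → 2 ≤ ∣ e ∣ → e ∈ₗ properEdges
  ∈-properEdges e∈E = ∈-filter⁺ (λ e → 2 ≤? ∣ e ∣) (∈-deduplicate⁺ (≡-dec _≟𝔹_) e∈E)

  potential : Subset (nV H) → ℕ
  potential G = ∣ G ∣ + uncovered G properEdges

  potential-insert≤ : ∀ v G → potential (insert v G) ≤ suc (potential G)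
  potential-insert≤ v G =
    +-mono-≤ (∣insert[x,p]∣≤1+∣p∣ v G) (uncovered-antitone (p⊆insert[x,p] v) properEdges)

  potential-ignite≤ : ∀ {F G v} → F ⊆ G → v ∉ G → Ignites H F v → potential (insert v G) ≤ potential G
  potential-ignite≤ {F} {G} {v} F⊆G v∉G (_ , e , e∈E , 2≤∣e∣ , v∈e , e-v⊆F) = begin
    ∣ insert v G ∣ + uncovered (insert v G) properEdges
      ≤⟨ +-monoˡ-≤ _ (∣insert[x,p]∣≤1+∣p∣ v G) ⟩
    suc ∣ G ∣ + uncovered (insert v G) properEdges
      ≡⟨ sym (+-suc ∣ G ∣ _) ⟩
    ∣ G ∣ + suc (uncovered (insert v G) properEdges)
      ≤⟨ +-monoʳ-≤ ∣ G ∣ (uncovered-antitone-strict (p⊆insert[x,p] v) properEdges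
                             (∈-properEdges e∈E 2≤∣e∣) (λ e⊆G → v∉G (e⊆G v∈e)) e⊆insert[v,G]) ⟩
    ∣ G ∣ + uncovered G properEdges ∎
    where
    open ≤-Reasoning
    e⊆insert[v,G] : e ⊆ insert v G
    e⊆insert[v,G] {w} w∈e with w ≟ᶠ v
    ... | yes refl = x∈insert[x,p] v G
    ... | no  w≢v  = p⊆insert[x,p] v (F⊆G (e-v⊆F w w∈e w≢v))

  potential-step≤ : ∀ {F u F'} → Step H F u F' → potential F' ≤ suc (potential F)
  potential-step≤ {F} {u} {F'} (_ , rule) =
    ≤-trans (Φ[T]≤Φ[B] F' potential insertion-nonincreasing B⊆F') (potential-insert≤ u F)
    where
    B⊆F' : insert u F ⊆ F'
    B⊆F' = insert-⊆ (proj₂ (rule u) (inj₂ (inj₁ refl))) (λ {v} v∈F → proj₂ (rule v) (inj₁ v∈F))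
    insertion-nonincreasing : ∀ {G} v → insert u F ⊆ G → v ∈ F' → potential (insert v G) ≤ potential G
    insertion-nonincreasing {G} v B⊆G v∈F' with v ∈? G
    ... | yes v∈G = ≤-reflexive (cong potential (x∈p⇒insert[x,p]≡p v v∈G))
    ... | no  v∉G with proj₁ (rule v) v∈F'
    ...   | inj₁ v∈F        = contradiction (B⊆G (p⊆insert[x,p] u v∈F)) v∉G
    ...   | inj₂ (inj₁ refl) = contradiction (B⊆G (x∈insert[x,p] u F)) v∉G
    ...   | inj₂ (inj₂ ignites) = potential-ignite≤ (⊆-trans (p⊆insert[x,p] u) B⊆G) v∉G ignites

  burning-bound : ∀ {F us} → BurnsFrom H F us → nV H ≤ potential F + length us
  burning-bound {F} (done all-burnt) = begin
    nV H                  ≡⟨ sym (∣⊤∣≡n (nV H)) ⟩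
    ∣ ⊤ {nV H} ∣          ≤⟨ p⊆q⇒∣p∣≤∣q∣ {p = ⊤ {nV H}} (λ {v} _ → all-burnt v) ⟩
    ∣ F ∣                 ≤⟨ m≤m+n ∣ F ∣ _ ⟩
    potential F           ≡⟨ sym (+-identityʳ _) ⟩
    potential F + 0       ∎
    where open ≤-Reasoning
  burning-bound {F} {u ∷ us} (step st burns) = begin
    nV H                        ≤⟨ burning-bound burns ⟩
    potential _ + length us     ≤⟨ +-monoˡ-≤ (length us) (potential-step≤ st) ⟩
    suc (potential F) + length us ≡⟨ sym (+-suc (potential F) (length us)) ⟩
    potential F + length (u ∷ us) ∎
    where open ≤-Reasoning

mainTheorem10 : (H : Hypergraph) (us : List (Vertex H)) →
    IsBurningSequence H us → nV H ≤ calE H + length us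
mainTheorem10 H us burns = ≤-trans (burning-bound H burns) (+-monoˡ-≤ (length us) potential[∅]≤calE)
  where
  potential[∅]≤calE : potential H ⊥ ≤ calE H
  potential[∅]≤calE rewrite ∣⊥∣≡0 (nV H) = uncovered≤length ⊥ (properEdges H)
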